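{- Let $d\ge1$, $c\ge1$, $k_1,\ldots,k_c\ge2$. For $n\ge1$ let $G_{n,d}$ be the graph on $\{1,\ldots,n\}$ in which distinct $a,b$ are adjacent iff $\gcd(a,b)=d$. Let $R^{\mathrm{edge}}_{\gcd=d}(k_1,\ldots,k_c)$ be the least $n$ such that every coloring of the edges of $G_{n,d}$ with colors $1,\ldots,c$ contains, for some $i$, a clique of $G_{n,d}$ on $k_i$ vertices all of whose edges have color $i$. Then \[ R^{\mathrm{edge}}_{\gcd=d}(k_1,\ldots,k_c)=d\,p_{R_{\mathrm{cl}}(k_1,\ldots,k_c)-1}, \] where $p_m$ is the $m$-th prime ($p_1=2$) and $R_{\mathrm{cl}}(k_1,\ldots,k_c)$ is the least $N$ such that every $c$-edge-coloring of $K_N$ contains, for some $i$, a $K_{k_i}$ with all edges of color $i$. -}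

module Defs where

open import Data.Nat using (ℕ; zero; suc; _≤_; _<_; _*_; _∸_)
open import Data.Nat.GCD using (gcd)
open import Data.Nat.Primality using (Prime; prime?)
open import Data.Fin using (Fin) renaming (_<_ to _<ᶠ_)
open import Data.Product using (Σ; _×_; ∃)
open import Data.Bool using (if_then_else_)
open import Relation.Nullary using (does)
open import Relation.Binary.PropositionalEquality using (_≡_)

IsLeast : (ℕ → Set) → ℕ → Set
IsLeast P n = P n × (∀ m → P m → n ≤ m)

primeCount : ℕ → ℕ
primeCount zero    = 0
primeCount (suc x) = if does (prime? (suc x)) then suc (primeCount x) else primeCount x

IsNthPrime : ℕ → ℕ → Set
IsNthPrime m p = Prime p × primeCount p ≡ m

-- Edge colouring with c colours: col a b is the colour of the edge {a,b},
-- read only for a < b (so a colouring of unordered edges).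
Colouring : ℕ → Set
Colouring c = ℕ → ℕ → Fin c

MonoCliqueK : (N c : ℕ) → Colouring c → ℕ → Fin c → Set
MonoCliqueK N c col k i =
  Σ (Fin k → ℕ) λ f →
    (∀ a → f a < N) ×
    (∀ a b → a <ᶠ b → (f a < f b) × (col (f a) (f b) ≡ i))

RamseyProp : (c : ℕ) → (Fin c → ℕ) → ℕ → Set
RamseyProp c ks N = ∀ (col : Colouring c) → ∃ λ i → MonoCliqueK N c col (ks i) i

MonoCliqueGcd : (n d c : ℕ) → Colouring c → ℕ → Fin c → Set
MonoCliqueGcd n d c col k i =
  Σ (Fin k → ℕ) λ f →
    (∀ a → (1 ≤ f a) × (f a ≤ n)) ×
    (∀ a b → a <ᶠ b → (f a < f b) × (gcd (f a) (f b) ≡ d) × (col (f a) (f b) ≡ i))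

GcdRamseyProp : (d c : ℕ) → (Fin c → ℕ) → ℕ → Set
GcdRamseyProp d c ks n = ∀ (col : Colouring c) → ∃ λ i → MonoCliqueGcd n d c col (ks i) i

module Submission where

-- The numbers d·1, d·p₁, …, d·p_{N-1} form a copy of K_N inside G_{d·p_{N-1},d}, so every
-- colouring of the latter induces one of K_N. Conversely, a clique of G_{n,d} is d times a
-- set of pairwise coprime numbers; for n < d·p_{N-1} these lie below p_{N-1}, so the index of
-- a prime factor (0 for the number 1) maps the clique injectively into {0, …, N-2}. A
-- monochromatic clique for the colouring of G_{n,d} pulled back along this map therefore
-- yields one of K_{N-1}, which contradicts the minimality of N.

open import Defs
open import Data.Nat
  using (ℕ; zero; suc; _≤_; _<_; _>_; _+_; _*_; _⊓_; _⊔_; _∸_; z≤n; s≤s)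
open import Data.Nat using (NonZero; >-nonZero; >-nonZero⁻¹)
open import Data.Nat.Properties
open import Data.Nat.Divisibility using (_∣_; ∣⇒≤; ∣1⇒≡1; m∣m*n)
open import Data.Nat.DivMod using (_/_; m/n*n≡m; m≥n⇒m/n>0; m<n*o⇒m/o<n)
open import Data.Nat.GCD using (gcd; c*gcd[m,n]≡gcd[cm,cn]; gcd[m,n]∣m; gcd[m,n]∣n; gcd-greatest)
open import Data.Nat.Coprimality
  using (prime⇒coprime; coprime⇒gcd≡1; coprime-/gcd) renaming (sym to coprime-sym)
open import Data.Nat.Primality using (Prime; prime?; ¬prime[0]; ¬prime[1]; prime⇒nonZero)
open import Data.Nat.Primality.Factorisation using (factorise)
open import Data.Nat.ListAction using (product)
open import Data.Fin using (Fin; zero; suc; punchIn) renaming (_<_ to _<ᶠ_)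
open import Data.Fin.Properties using (punchIn-injective; punchInᵢ≢i) renaming (<-cmp to <ᶠ-cmp)
open import Data.List using (_∷_; allFin)
open import Data.List.Extrema.Nat using (argmin; f[argmin]≤f[xs])
open import Data.List.Membership.Propositional.Properties using (∈-allFin)
import Data.List.Relation.Unary.All as All
open import Data.Product using (_×_; _,_; ∃; proj₁; proj₂)
open import Data.Sum using (inj₁; inj₂)
open import Function using (_∘_)
open import Function.Definitions using (Injective)
open import Relation.Binary.Core using (_Preserves_⟶_)
open import Relation.Binary.Definitions using (tri<; tri≈; tri>)
open import Relation.Binary.PropositionalEquality
open import Relation.Nullary using (yes; no; contradiction)
open import Relation.Nullary.Decidable using (_×-dec_)

ramsey⇒gcdRamsey : ∀ {d c ks N n} (v : ℕ → ℕ) →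
  (∀ {j} → j < N → 1 ≤ v j × v j ≤ n) →
  (∀ {i j} → i < j → j < N → v i < v j × gcd (v i) (v j) ≡ d) →
  RamseyProp c ks N → GcdRamseyProp d c ks n
ramsey⇒gcdRamsey v v-vertex v-edge ramsey col with ramsey (λ a b → col (v a) (v b))
... | i , f , f<N , f-clique = i , v ∘ f , (λ a → v-vertex (f<N a)) , λ a b a<b →
  let (f[a]<f[b] , colour) = f-clique a b a<b
      (v<v , gcd≡d)        = v-edge f[a]<f[b] (f<N b)
  in  v<v , gcd≡d , colour

minimiser : ∀ {k} (g : Fin (suc k) → ℕ) → ∃ λ m → ∀ b → g m ≤ g b
minimiser {k} g = argmin g zero (allFin (suc k)) ,
  λ b → All.lookup (f[argmin]≤f[xs] {f = g} zero (allFin (suc k))) (∈-allFin b)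

increasing-reindexing : ∀ {k} (g : Fin k → ℕ) → Injective _≡_ _≡_ g →
  ∃ λ (σ : Fin k → Fin k) → (g ∘ σ) Preserves _<ᶠ_ ⟶ _<_
increasing-reindexing {zero} g g-injective = (λ ()) , λ {}
increasing-reindexing {suc k} g g-injective with minimiser g
... | m , g[m]-minimal with increasing-reindexing (g ∘ punchIn m) (punchIn-injective m _ _ ∘ g-injective)
...   | τ , g∘punchIn∘τ-increasing = σ , σ-increasing
  where
  σ : Fin (suc k) → Fin (suc k)
  σ zero    = m
  σ (suc a) = punchIn m (τ a)

  σ-increasing : (g ∘ σ) Preserves _<ᶠ_ ⟶ _<_
  σ-increasing {zero}  {suc b} _         =
    ≤∧≢⇒< (g[m]-minimal _) (punchInᵢ≢i m (τ b) ∘ sym ∘ g-injective)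
  σ-increasing {suc a} {suc b} (s≤s a<b) = g∘punchIn∘τ-increasing a<b

-- Colourings are only read on increasing pairs, hence the symmetrisation.
colourVia : ∀ {c} → (ℕ → ℕ) → Colouring c → Colouring c
colourVia h col x y = col (h x ⊓ h y) (h x ⊔ h y)

colourVia-comm : ∀ {c} h (col : Colouring c) x y → colourVia h col x y ≡ colourVia h col y x
colourVia-comm h col x y = cong₂ col (⊓-comm (h x) (h y)) (⊔-comm (h x) (h y))

colourVia-< : ∀ {c} h (col : Colouring c) {x y} → h x < h y → colourVia h col x y ≡ col (h x) (h y)
colourVia-< h col h[x]<h[y] =
  cong₂ col (m≤n⇒m⊓n≡m (<⇒≤ h[x]<h[y])) (m≤n⇒m⊔n≡n (<⇒≤ h[x]<h[y]))

module _ {d c n M} (h : ℕ → ℕ) (col : Colouring c)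
         (h-bounded : ∀ {x} → x ≤ n → h x < M)
         (h-proper : ∀ {x y} → 1 ≤ x → x < y → gcd x y ≡ d → h x ≢ h y) where

  monoCliqueGcd⇒monoCliqueK : ∀ {k i} →
    MonoCliqueGcd n d c (colourVia h col) k i → MonoCliqueK M c col k i
  monoCliqueGcd⇒monoCliqueK {k} {i} (f , f-vertex , f-clique) =
    h ∘ f ∘ σ , (λ a → h-bounded (proj₂ (f-vertex (σ a)))) ,
    λ a b a<b → σ-increasing a<b , colour (σ-increasing a<b)
    where
    edge : ∀ {a b} → a <ᶠ b → h (f a) ≢ h (f b) × colourVia h col (f a) (f b) ≡ i
    edge {a} {b} a<b = let (f[a]<f[b] , gcd≡d , colour) = f-clique a b a<b in
      h-proper (proj₁ (f-vertex a)) f[a]<f[b] gcd≡d , colour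

    h∘f-injective : Injective _≡_ _≡_ (h ∘ f)
    h∘f-injective {a} {b} eq with <ᶠ-cmp a b
    ... | tri< a<b _ _ = contradiction eq (proj₁ (edge a<b))
    ... | tri≈ _ a≡b _ = a≡b
    ... | tri> _ _ b<a = contradiction (sym eq) (proj₁ (edge b<a))

    σ : Fin k → Fin k
    σ = proj₁ (increasing-reindexing (h ∘ f) h∘f-injective)

    σ-increasing : (h ∘ f ∘ σ) Preserves _<ᶠ_ ⟶ _<_
    σ-increasing = proj₂ (increasing-reindexing (h ∘ f) h∘f-injective)

    colour : ∀ {a b} → h (f a) < h (f b) → col (h (f a)) (h (f b)) ≡ i
    colour {a} {b} lt with <ᶠ-cmp a b
    ... | tri< a<b _ _  = trans (sym (colourVia-< h col lt)) (proj₂ (edge a<b))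
    ... | tri≈ _ refl _ = contradiction lt (<-irrefl refl)
    ... | tri> _ _ b<a  =
      trans (sym (colourVia-< h col lt)) (trans (colourVia-comm h col (f a) (f b)) (proj₂ (edge b<a)))

gcdRamsey⇒ramsey : ∀ {d c ks n M} (h : ℕ → ℕ) →
  (∀ {x} → x ≤ n → h x < M) →
  (∀ {x y} → 1 ≤ x → x < y → gcd x y ≡ d → h x ≢ h y) →
  GcdRamseyProp d c ks n → RamseyProp c ks M
gcdRamsey⇒ramsey h h-bounded h-proper gcdRamsey col =
  let (i , clique) = gcdRamsey (colourVia h col)
  in  i , monoCliqueGcd⇒monoCliqueK h col h-bounded h-proper clique

primeCount-suc-prime : ∀ {x} → Prime (suc x) → primeCount (suc x) ≡ suc (primeCount x)
primeCount-suc-prime {x} p with prime? (suc x)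
... | yes _ = refl
... | no ¬p = contradiction p ¬p

primeCount-≤-suc : ∀ x → primeCount x ≤ primeCount (suc x)
primeCount-≤-suc x with prime? (suc x)
... | yes _ = n≤1+n _
... | no _  = ≤-refl

primeCount-mono-≤ : ∀ {m n} → m ≤ n → primeCount m ≤ primeCount n
primeCount-mono-≤ {n = zero} z≤n = ≤-refl
primeCount-mono-≤ {m} {suc n} m≤1+n with m≤n⇒m<n∨m≡n m≤1+n
... | inj₁ (s≤s m≤n) = ≤-trans (primeCount-mono-≤ m≤n) (primeCount-≤-suc n)
... | inj₂ refl      = ≤-refl

primeCount-mono-<-prime : ∀ {m p} → Prime p → m < p → primeCount m < primeCount p
primeCount-mono-<-prime {p = zero} p-prime _ = contradiction p-prime ¬prime[0]
primeCount-mono-<-prime {p = suc p} p-prime (s≤s m≤p) =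
  subst (_ <_) (sym (primeCount-suc-prime p-prime)) (s≤s (primeCount-mono-≤ m≤p))

primeCount[p]>0 : ∀ {p} → Prime p → primeCount p > 0
primeCount[p]>0 {suc _} p-prime = primeCount-mono-<-prime p-prime (s≤s z≤n)

primeCount-injective-on-primes : ∀ {p q} → Prime p → Prime q → primeCount p ≡ primeCount q → p ≡ q
primeCount-injective-on-primes {p} {q} p-prime q-prime eq with <-cmp p q
... | tri< p<q _ _ = contradiction eq (<⇒≢ (primeCount-mono-<-prime q-prime p<q))
... | tri≈ _ p≡q _ = p≡q
... | tri> _ _ q<p = contradiction (sym eq) (<⇒≢ (primeCount-mono-<-prime p-prime q<p))

-- The search returns 1 when there is no such prime; in particular 1 serves as the 0-th prime.
nthPrimeUpTo : ℕ → ℕ → ℕ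
nthPrimeUpTo zero    j = 1
nthPrimeUpTo (suc x) j with prime? (suc x) ×-dec primeCount (suc x) ≟ j
... | yes _ = suc x
... | no _  = nthPrimeUpTo x j

nthPrimeUpTo-zero : ∀ x → nthPrimeUpTo x 0 ≡ 1
nthPrimeUpTo-zero zero = refl
nthPrimeUpTo-zero (suc x) with prime? (suc x) ×-dec primeCount (suc x) ≟ 0
... | yes (p , π≡0) = contradiction π≡0 (>⇒≢ (primeCount[p]>0 p))
... | no _          = nthPrimeUpTo-zero x

nthPrimeUpTo-isNthPrime : ∀ x {j} → 1 ≤ j → j ≤ primeCount x →
  IsNthPrime j (nthPrimeUpTo x j) × nthPrimeUpTo x j ≤ x
nthPrimeUpTo-isNthPrime zero 1≤j j≤0 = contradiction (≤-trans 1≤j j≤0) λ ()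
nthPrimeUpTo-isNthPrime (suc x) {j} 1≤j j≤π with prime? (suc x) ×-dec primeCount (suc x) ≟ j
... | yes found = found , ≤-refl
... | no ¬found = let (isNth , ≤x) = nthPrimeUpTo-isNthPrime x 1≤j j≤π[x] in isNth , m≤n⇒m≤1+n ≤x
  where
  j≤π[x] : j ≤ primeCount x
  j≤π[x] with prime? (suc x)
  ... | no _ = j≤π
  ... | yes p with m≤n⇒m<n∨m≡n j≤π
  ...   | inj₁ (s≤s j≤π[x]) = j≤π[x]
  ...   | inj₂ refl         = contradiction (p , refl) ¬found

module PrimeClique {p} (p-prime : Prime p) where

  q : ℕ → ℕ
  q = nthPrimeUpTo p

  q-spec : ∀ {j} → j ≤ primeCount p → 1 ≤ q j × q j ≤ p × primeCount (q j) ≡ j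
  q-spec {zero} _ rewrite nthPrimeUpTo-zero p = ≤-refl , >-nonZero⁻¹ p {{prime⇒nonZero p-prime}} , refl
  q-spec {suc j} j≤π with nthPrimeUpTo-isNthPrime p (s≤s z≤n) j≤π
  ... | (q-prime , π[q]≡j) , q≤p = >-nonZero⁻¹ _ {{prime⇒nonZero q-prime}} , q≤p , π[q]≡j

  q-increasing : ∀ {i j} → i < j → j ≤ primeCount p → q i < q j
  q-increasing {i} {j} i<j j≤π = ≰⇒> λ q[j]≤q[i] → <⇒≱ i<j (begin
    j                ≡⟨ π[q[j]]≡j ⟨
    primeCount (q j) ≤⟨ primeCount-mono-≤ q[j]≤q[i] ⟩
    primeCount (q i) ≡⟨ π[q[i]]≡i ⟩
    i                ∎)
    where
    open ≤-Reasoning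
    π[q[j]]≡j : primeCount (q j) ≡ j
    π[q[j]]≡j = proj₂ (proj₂ (q-spec j≤π))
    π[q[i]]≡i : primeCount (q i) ≡ i
    π[q[i]]≡i = proj₂ (proj₂ (q-spec (≤-trans (<⇒≤ i<j) j≤π)))

  q-coprime : ∀ {i j} → i < j → j ≤ primeCount p → gcd (q i) (q j) ≡ 1
  q-coprime {i} {suc j} i<j j≤π =
    coprime⇒gcd≡1 (coprime-sym (prime⇒coprime q[j]-prime {{>-nonZero q[i]>0}} (q-increasing i<j j≤π)))
    where
    q[j]-prime : Prime (q (suc j))
    q[j]-prime = proj₁ (proj₁ (nthPrimeUpTo-isNthPrime p (s≤s z≤n) j≤π))
    q[i]>0 : q i > 0
    q[i]>0 = proj₁ (q-spec (≤-trans (<⇒≤ i<j) j≤π))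

ramsey⇒gcdRamsey[d*p] : ∀ {d c ks p} .{{_ : NonZero d}} → Prime p →
  RamseyProp c ks (suc (primeCount p)) → GcdRamseyProp d c ks (d * p)
ramsey⇒gcdRamsey[d*p] {d} {p = p} p-prime = ramsey⇒gcdRamsey (λ j → d * q j) vertex edge
  where
  open PrimeClique p-prime

  vertex : ∀ {j} → j < suc (primeCount p) → 1 ≤ d * q j × d * q j ≤ d * p
  vertex (s≤s j≤π) = let (1≤q , q≤p , _) = q-spec j≤π in
    *-mono-≤ (>-nonZero⁻¹ d) 1≤q , *-monoʳ-≤ d q≤p

  edge : ∀ {i j} → i < j → j < suc (primeCount p) → d * q i < d * q j × gcd (d * q i) (d * q j) ≡ d
  edge {i} {j} i<j (s≤s j≤π) = *-monoʳ-< d (q-increasing i<j j≤π) , (begin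
    gcd (d * q i) (d * q j) ≡⟨ c*gcd[m,n]≡gcd[cm,cn] d (q i) (q j) ⟨
    d * gcd (q i) (q j)     ≡⟨ cong (d *_) (q-coprime i<j j≤π) ⟩
    d * 1                   ≡⟨ *-identityʳ d ⟩
    d                       ∎)
    where open ≡-Reasoning

primeFactor : ∀ n → ∃ λ q → Prime q × q ∣ 2 + n
primeFactor n with factorise (2 + n)
... | record { factors = q ∷ qs ; isFactorisation = 2+n≡q*Πqs ; factorsPrime = q-prime All.∷ _ } =
  q , q-prime , subst (q ∣_) (sym 2+n≡q*Πqs) (m∣m*n (product qs))

primeFactorIndex : ℕ → ℕ
primeFactorIndex (suc (suc n)) = primeCount (proj₁ (primeFactor n))
primeFactorIndex _             = 0

primeFactorIndex-< : ∀ {a p} → Prime p → a < p → primeFactorIndex a < primeCount p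
primeFactorIndex-< {zero}        p-prime _   = primeCount[p]>0 p-prime
primeFactorIndex-< {suc zero}    p-prime _   = primeCount[p]>0 p-prime
primeFactorIndex-< {suc (suc n)} p-prime a<p =
  let (_ , _ , q∣a) = primeFactor n in primeCount-mono-<-prime p-prime (≤-<-trans (∣⇒≤ q∣a) a<p)

primeFactorIndex-injective-coprime : ∀ {a b} → 1 ≤ a → a < b → gcd a b ≡ 1 →
  primeFactorIndex a ≢ primeFactorIndex b
primeFactorIndex-injective-coprime {suc zero}    {suc zero}    _ (s≤s ())
primeFactorIndex-injective-coprime {suc (suc _)} {suc zero}    _ (s≤s ())
primeFactorIndex-injective-coprime {suc zero}    {suc (suc n)} _ _ _ =
  <⇒≢ (primeCount[p]>0 (proj₁ (proj₂ (primeFactor n))))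
primeFactorIndex-injective-coprime {suc (suc m)} {suc (suc n)} _ _ gcd≡1 π[qa]≡π[qb]
  with primeFactor m | primeFactor n
... | qa , qa-prime , qa∣a | qb , qb-prime , qb∣b = ¬prime[1] (subst Prime qa≡1 qa-prime)
  where
  qa∣b : qa ∣ 2 + n
  qa∣b = subst (_∣ 2 + n) (sym (primeCount-injective-on-primes qa-prime qb-prime π[qa]≡π[qb])) qb∣b
  qa≡1 : qa ≡ 1
  qa≡1 = ∣1⇒≡1 (subst (qa ∣_) gcd≡1 (gcd-greatest qa∣a qa∣b))

gcd≡d⇒coprime[/d] : ∀ {x y d} .{{_ : NonZero d}} → gcd x y ≡ d → gcd (x / d) (y / d) ≡ 1
gcd≡d⇒coprime[/d] {x} {y} refl = coprime⇒gcd≡1 (coprime-/gcd x y)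

gcdRamsey⇒ramsey[primeCount] : ∀ {d c ks m p} .{{_ : NonZero d}} → Prime p → m < d * p →
  GcdRamseyProp d c ks m → RamseyProp c ks (primeCount p)
gcdRamsey⇒ramsey[primeCount] {d} {m = m} {p} p-prime m<d*p =
  gcdRamsey⇒ramsey (λ x → primeFactorIndex (x / d)) bounded proper
  where
  bounded : ∀ {x} → x ≤ m → primeFactorIndex (x / d) < primeCount p
  bounded {x} x≤m = primeFactorIndex-< p-prime (m<n*o⇒m/o<n (begin-strict
    x     ≤⟨ x≤m ⟩
    m     <⟨ m<d*p ⟩
    d * p ≡⟨ *-comm d p ⟩
    p * d ∎))
    where open ≤-Reasoning

  proper : ∀ {x y} → 1 ≤ x → x < y → gcd x y ≡ d →
    primeFactorIndex (x / d) ≢ primeFactorIndex (y / d)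
  proper {x} {y} 1≤x x<y gcd≡d =
    primeFactorIndex-injective-coprime x/d>0 x/d<y/d (gcd≡d⇒coprime[/d] gcd≡d)
    where
    d∣x : d ∣ x
    d∣x = subst (_∣ x) gcd≡d (gcd[m,n]∣m x y)
    d∣y : d ∣ y
    d∣y = subst (_∣ y) gcd≡d (gcd[m,n]∣n x y)
    x/d>0 : x / d > 0
    x/d>0 = m≥n⇒m/n>0 (∣⇒≤ {{>-nonZero 1≤x}} d∣x)
    x/d<y/d : x / d < y / d
    x/d<y/d = *-cancelʳ-< d (x / d) (y / d) (subst₂ _<_ (sym (m/n*n≡m d∣x)) (sym (m/n*n≡m d∣y)) x<y)

corollary4p7 : (d c : ℕ) → 1 ≤ d → 1 ≤ c → (ks : Fin c → ℕ) → (∀ i → 2 ≤ ks i) →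
    (N : ℕ) → IsLeast (RamseyProp c ks) N →
    (p : ℕ) → IsNthPrime (N ∸ 1) p →
    IsLeast (GcdRamseyProp d c ks) (d * p)
corollary4p7 (suc _) c _ _ ks _ zero _ p (p-prime , π[p]≡0) =
  contradiction π[p]≡0 (>⇒≢ (primeCount[p]>0 p-prime))
corollary4p7 (suc _) c _ _ ks _ (suc N) (ramsey , N-least) p (p-prime , refl) =
  ramsey⇒gcdRamsey[d*p] p-prime ramsey ,
  λ m gcdRamsey → ≮⇒≥ λ m<d*p →
    n≮n N (N-least N (gcdRamsey⇒ramsey[primeCount] p-prime m<d*p gcdRamsey))
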